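{- Let $s_{d},\ldots,s_{1} \in \mathbb{N}^{\ast}$ and consider the sequence $\big(\mathrm{har}_{p^{\alpha}}(s_{d},\ldots,s_{1})\big)_{p \text{ prime},\, \alpha \in \mathbb{N}^{\ast}}$, where $$ \mathrm{har}_{n}(s_{d},\ldots,s_{1}) = n^{s_{d}+\ldots+s_{1}} \sum_{0<n_{1}<\ldots<n_{d}<n} \frac{1}{n_{1}^{s_{1}}\ldots n_{d}^{s_{d}}} \in \mathbb{Q}. $$ Any infinite subsequence of this sequence, viewed as an element $a$ of $\prod_{I} \mathbb{Q} \subset \prod_{I} \mathbb{C}$ with $I$ an infinite set of prime powers, is transcendental, i.e. there is no non-zero polynomial $P \in \mathbb{Q}[T]$ with $P(a)=0$ (componentwise).
   Context: These are the weighted multiple harmonic sums of $\mathbb{P}^{1} - \{0,1,\infty\}$ evaluated at prime powers $n = p^{\alpha}$. An element of a product of $\mathbb{Q}$-algebras contained in $\mathbb{C}$ is algebraic if it is a root of a non-zero polynomial with rational coefficients, acting componentwise; it is transcendental otherwise. -}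

module Defs where

open import Data.Nat as ℕ using (ℕ; zero; suc; _<_; _≤_)
open import Data.Nat.Properties using (m^n≢0)
open import Data.Nat.Primality using (Prime)
open import Data.Integer using (+_)
open import Data.Rational using (ℚ; 0ℚ; 1ℚ; _+_; _*_; _/_)
open import Data.List using (List; []; _∷_)
open import Data.Nat.ListAction using (sum)
open import Data.List.Relation.Unary.Any using (Any)
open import Data.Empty using (⊥)
open import Data.List.Relation.Unary.All using (All)
open import Data.Product using (Σ; ∃; _×_)
open import Relation.Binary.PropositionalEquality using (_≡_)

-- The multi-index is written as the list  s_d ∷ ... ∷ s_1 ∷ []  (paper's order).

-- S m (s_d ∷ ... ∷ s_1 ∷ [])  =  Σ_{0<n_1<...<n_d<m} 1/(n_1^{s_1} ... n_d^{s_d})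
-- computed by recursion on the largest index n_d = k:
--   S m []       = 1  (empty sum over the single empty tuple)
--   S m (s ∷ ss) = Σ_{0<k<m} (1/k^s) · S k ss
nestedSum : ℕ → List ℕ → ℚ
nestedSum m [] = 1ℚ
nestedSum zero (s ∷ ss) = 0ℚ
nestedSum (suc m) (s ∷ ss) = go m
  where
  go : ℕ → ℚ
  go zero = 0ℚ
  go (suc j) = go j + ((+ 1) / (suc j ℕ.^ s)) {{m^n≢0 (suc j) s}} * nestedSum (suc j) ss

weight : List ℕ → ℕ
weight = sum

har : ℕ → List ℕ → ℚ
har n s = ((+ (n ℕ.^ weight s)) / 1) * nestedSum n s

IsPrimePower : ℕ → Set
IsPrimePower n = Σ ℕ λ p → Σ ℕ λ α → Prime p × 1 ≤ α × n ≡ p ℕ.^ α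

Infinite : (ℕ → Set) → Set
Infinite I = ∀ m → ∃ λ n → m < n × I n

-- Polynomials in ℚ[T] as coefficient lists  c_0 ∷ c_1 ∷ ... (lowest degree first).
Poly : Set
Poly = List ℚ

eval : Poly → ℚ → ℚ
eval [] x = 0ℚ
eval (c ∷ cs) x = c + x * eval cs x

NonZeroPoly : Poly → Set
NonZeroPoly P = Any (λ c → c ≡ 0ℚ → ⊥) P

AlgebraicFamily : (I : ℕ → Set) → ((n : ℕ) → I n → ℚ) → Set
AlgebraicFamily I a = Σ Poly λ P → NonZeroPoly P × (∀ n (i : I n) → eval P (a n i) ≡ 0ℚ)

module Submission where

-- A non-zero polynomial P ∈ ℚ[T] is eventually bounded
-- away from zero: there are B and δ > 0 with δ ≤ |P(x)| for every x ≥ B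
-- (induction on the Horner form  P = c + T·Q).  Hence a family of rationals
-- taking arbitrarily large values on its index set cannot be killed by any
-- non-zero polynomial.  It remains to see that har_n(s) is unbounded: for
-- a non-empty multi-index with all s_i ≥ 1 and n > d = length s one has
-- har_n(s) ≥ n, obtained by keeping a single term of the nested sum.  Since
-- the index set I is infinite, it contains arbitrarily large n, so the
-- family is transcendental.

open import Defs
open import Data.Nat as ℕ using (ℕ; zero; suc)
import Data.Nat.Properties as ℕP
open import Data.Integer as ℤ using (+_; -[1+_])
import Data.Integer.Properties as ℤP
open import Data.Rational as ℚ using (ℚ; 0ℚ; 1ℚ; _+_; _*_; _/_; -_; ∣_∣; 1/_; _≤_; _<_; _⊔_; mkℚ; toℚᵘ; *≤*)
import Data.Rational.Properties as ℚP
open import Data.Rational.Unnormalised as ℚᵘ using (mkℚᵘ; _≃_)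
import Data.Rational.Unnormalised.Properties as ℚᵘP
open import Data.Rational.Solver using (module +-*-Solver)
open import Data.List using (List; []; _∷_; length)
open import Data.List.Relation.Unary.All using (All; []; _∷_)
open import Data.List.Relation.Unary.Any as Any using (here; there)
open import Data.Product using (Σ; ∃; _×_; _,_)
open import Data.Empty using (⊥-elim)
open import Relation.Nullary using (¬_; yes; no)
open import Relation.Nullary.Decidable using (decidable-stable; ¬?)
open import Relation.Binary using (tri<; tri≈; tri>)
open import Relation.Binary.PropositionalEquality

open +-*-Solver using (solve; _:+_; _:*_; :-_; _:=_)

ι : ℕ → ℚ
ι a = + a / 1

toℚᵘ-fraction : ∀ a k → toℚᵘ (+ a / suc k) ≃ mkℚᵘ (+ a) k
toℚᵘ-fraction a k = ℚP.toℚᵘ-fromℚᵘ (mkℚᵘ (+ a) k)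

ι-mono-≤ : ∀ {a b} → a ℕ.≤ b → ι a ≤ ι b
ι-mono-≤ {a} {b} a≤b = ℚP.toℚᵘ-cancel-≤
  (ℚᵘP.≤-respʳ-≃ (ℚᵘP.≃-sym (toℚᵘ-fraction b 0)) (ℚᵘP.≤-respˡ-≃ (ℚᵘP.≃-sym (toℚᵘ-fraction a 0))
    (ℚᵘ.*≤* (subst₂ ℤ._≤_ (ℤP.pos-* a 1) (ℤP.pos-* b 1) (ℤ.+≤+ (ℕP.*-monoˡ-≤ 1 a≤b))))))

ι-* : ∀ a b → ι (a ℕ.* b) ≡ ι a * ι b
ι-* a b = ℚP.toℚᵘ-injective (ℚᵘP.≃-trans (toℚᵘ-fraction (a ℕ.* b) 0) (ℚᵘP.≃-trans product
  (ℚᵘP.≃-sym (ℚᵘP.≃-trans (ℚP.toℚᵘ-homo-* (ι a) (ι b)) (ℚᵘP.*-cong (toℚᵘ-fraction a 0) (toℚᵘ-fraction b 0))))))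
  where
  product : mkℚᵘ (+ (a ℕ.* b)) 0 ≃ mkℚᵘ (+ a) 0 ℚᵘ.* mkℚᵘ (+ b) 0
  product = ℚᵘ.*≡* (cong (ℤ._* + 1) (ℤP.pos-* a b))

ι-inverse : ∀ K .{{_ : ℕ.NonZero K}} → ι K * (+ 1 / K) ≡ 1ℚ
ι-inverse (suc k) = ℚP.toℚᵘ-injective (ℚᵘP.≃-trans (ℚP.toℚᵘ-homo-* (ι (suc k)) (+ 1 / suc k))
  (ℚᵘP.≃-trans (ℚᵘP.*-cong (toℚᵘ-fraction (suc k) 0) (toℚᵘ-fraction 1 k)) cancel))
  where
  cancel : mkℚᵘ (+ suc k) 0 ℚᵘ.* mkℚᵘ (+ 1) k ≃ ℚᵘ.1ℚᵘ
  cancel = ℚᵘ.*≡* (trans (ℤP.*-identityʳ _) (trans (ℤP.*-identityʳ (+ suc k))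
                   (sym (trans (ℤP.*-identityˡ _) (ℤP.*-identityˡ _)))))

archimedean : ∀ q → ∃ λ m → q ≤ ι m
archimedean (mkℚ (+ k) d _) = k , ℚP.toℚᵘ-cancel-≤ (ℚᵘP.≤-respʳ-≃ (ℚᵘP.≃-sym (toℚᵘ-fraction k 0))
  (ℚᵘ.*≤* (subst₂ ℤ._≤_ (ℤP.pos-* k 1) (ℤP.pos-* k (suc d)) (ℤ.+≤+ (ℕP.*-monoʳ-≤ k (ℕ.s≤s ℕ.z≤n))))))
archimedean (mkℚ -[1+ k ] d _) = 0 , ℚP.toℚᵘ-cancel-≤ (ℚᵘP.≤-respʳ-≃ (ℚᵘP.≃-sym (toℚᵘ-fraction 0 0)) (ℚᵘ.*≤* ℤ.-≤+))

0≤-fraction : ∀ a n .{{_ : ℕ.NonZero n}} → 0ℚ ≤ + a / n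
0≤-fraction a n = ℚP.nonNegative⁻¹ _ {{ℚP.normalize-nonNeg a n}}

0≤-ι : ∀ a → 0ℚ ≤ ι a
0≤-ι a = 0≤-fraction a 1

0≤-* : ∀ {p q} → 0ℚ ≤ p → 0ℚ ≤ q → 0ℚ ≤ p * q
0≤-* {p} {q} 0≤p 0≤q = ℚP.nonNegative⁻¹ _ {{ℚP.nonNeg*nonNeg⇒nonNeg p {{ℚ.nonNegative 0≤p}} q {{ℚ.nonNegative 0≤q}}}}

*-monoˡ-≤ : ∀ r {p q} → 0ℚ ≤ r → p ≤ q → r * p ≤ r * q
*-monoˡ-≤ r 0≤r = ℚP.*-monoˡ-≤-nonNeg r {{ℚ.nonNegative 0≤r}}

*-monoʳ-≤ : ∀ r {p q} → 0ℚ ≤ r → p ≤ q → p * r ≤ q * r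
*-monoʳ-≤ r 0≤r = ℚP.*-monoʳ-≤-nonNeg r {{ℚ.nonNegative 0≤r}}

p≤p+q : ∀ p {q} → 0ℚ ≤ q → p ≤ p + q
p≤p+q p {q} 0≤q = subst (_≤ p + q) (ℚP.+-identityʳ p) (ℚP.+-monoʳ-≤ p 0≤q)

p≤q+p : ∀ {q} p → 0ℚ ≤ q → p ≤ q + p
p≤q+p {q} p 0≤q = subst (_≤ q + p) (ℚP.+-identityˡ p) (ℚP.+-monoˡ-≤ p 0≤q)

+-cancelʳ-≤ : ∀ a b k → a + k ≤ b + k → a ≤ b
+-cancelʳ-≤ a b k a+k≤b+k = subst₂ _≤_ (undo a) (undo b) (ℚP.+-monoˡ-≤ (- k) a+k≤b+k)
  where
  undo : ∀ z → z + k + - k ≡ z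
  undo z = trans (ℚP.+-assoc z k (- k)) (trans (cong (λ w → z + w) (ℚP.+-inverseʳ k)) (ℚP.+-identityʳ z))

≤-divide : ∀ c A K .{{_ : ℕ.NonZero K}} → c ℕ.* K ℕ.≤ A → ι c ≤ ι A * (+ 1 / K)
≤-divide c A K cK≤A = begin
  ι c                       ≡⟨ sym (ℚP.*-identityʳ (ι c)) ⟩
  ι c * 1ℚ                  ≡⟨ cong (ι c *_) (sym (ι-inverse K)) ⟩
  ι c * (ι K * (+ 1 / K))   ≡⟨ sym (ℚP.*-assoc (ι c) (ι K) _) ⟩
  ι c * ι K * (+ 1 / K)     ≡⟨ cong (_* (+ 1 / K)) (sym (ι-* c K)) ⟩
  ι (c ℕ.* K) * (+ 1 / K)   ≤⟨ *-monoʳ-≤ _ (0≤-fraction 1 K) (ι-mono-≤ cK≤A) ⟩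
  ι A * (+ 1 / K)           ∎
  where open ℚP.≤-Reasoning

-- Nested harmonic sums

inversePower : ℕ → ℕ → ℚ
inversePower j s = (+ 1 / (suc j ℕ.^ s)) {{ℕP.m^n≢0 (suc j) s}}

0≤-inversePower : ∀ j s → 0ℚ ≤ inversePower j s
0≤-inversePower j s = 0≤-fraction 1 _ {{ℕP.m^n≢0 (suc j) s}}

nestedSum-step : ∀ j s ss → nestedSum (suc (suc j)) (s ∷ ss)
                          ≡ nestedSum (suc j) (s ∷ ss) + inversePower j s * nestedSum (suc j) ss
nestedSum-step j s ss = refl

nestedSum-nonNeg : ∀ m ss → 0ℚ ≤ nestedSum m ss
nestedSum-nonNeg m [] = *≤* (ℤ.+≤+ ℕ.z≤n)
nestedSum-nonNeg zero (s ∷ ss) = ℚP.≤-refl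
nestedSum-nonNeg (suc zero) (s ∷ ss) = ℚP.≤-refl
nestedSum-nonNeg (suc (suc j)) (s ∷ ss) =
  ℚP.+-mono-≤ (nestedSum-nonNeg (suc j) (s ∷ ss)) (0≤-* (0≤-inversePower j s) (nestedSum-nonNeg (suc j) ss))

nestedSum-mono : ∀ {m m′} s ss → m ℕ.≤ m′ → nestedSum m (s ∷ ss) ≤ nestedSum m′ (s ∷ ss)
nestedSum-mono s ss m≤m′ = mono (ℕP.≤⇒≤′ m≤m′)
  where
  mono-suc : ∀ m → nestedSum m (s ∷ ss) ≤ nestedSum (suc m) (s ∷ ss)
  mono-suc zero = ℚP.≤-refl
  mono-suc (suc j) = ℚP.≤-trans (p≤p+q _ (0≤-* (0≤-inversePower j s) (nestedSum-nonNeg (suc j) ss)))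
                                (ℚP.≤-reflexive (sym (nestedSum-step j s ss)))

  mono : ∀ {m m′} → m ℕ.≤′ m′ → nestedSum m (s ∷ ss) ≤ nestedSum m′ (s ∷ ss)
  mono ℕ.≤′-refl = ℚP.≤-refl
  mono {m′ = suc n} (ℕ.≤′-step m≤′n) = ℚP.≤-trans (mono m≤′n) (mono-suc n)

nestedSum-lastTerm : ∀ j s ss → inversePower j s * nestedSum (suc j) ss ≤ nestedSum (suc (suc j)) (s ∷ ss)
nestedSum-lastTerm j s ss =
  ℚP.≤-trans (p≤q+p _ (nestedSum-nonNeg (suc j) (s ∷ ss))) (ℚP.≤-reflexive (sym (nestedSum-step j s ss)))

nestedSum-firstTerm : ∀ j s → inversePower 0 s ≤ nestedSum (suc (suc j)) (s ∷ [])
nestedSum-firstTerm j s = ℚP.≤-trans (ℚP.≤-reflexive term) (nestedSum-mono {2} {suc (suc j)} s [] (ℕ.s≤s (ℕ.s≤s ℕ.z≤n)))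
  where
  term : inversePower 0 s ≡ nestedSum 2 (s ∷ [])
  term = sym (trans (ℚP.+-identityˡ _) (ℚP.*-identityʳ _))

powerRatio-≥1 : ∀ j N s → suc j ℕ.≤ N → 1ℚ ≤ ι (N ℕ.^ s) * inversePower j s
powerRatio-≥1 j N s k≤N = ≤-divide 1 (N ℕ.^ s) (suc j ℕ.^ s) {{ℕP.m^n≢0 (suc j) s}}
  (subst (ℕ._≤ N ℕ.^ s) (sym (ℕP.*-identityˡ _)) (ℕP.^-monoˡ-≤ s k≤N))

power-≥-base : ∀ N s → 1 ℕ.≤ N → 1 ℕ.≤ s → ι N ≤ ι (N ℕ.^ s) * inversePower 0 s
power-≥-base N (suc s) 1≤N _ = ≤-divide N (N ℕ.^ suc s) (1 ℕ.^ suc s) {{ℕP.m^n≢0 1 (suc s)}} N≤N^s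
  where
  N≤N^s : N ℕ.* 1 ℕ.^ suc s ℕ.≤ N ℕ.^ suc s
  N≤N^s rewrite ℕP.^-zeroˡ (suc s) | ℕP.*-identityʳ N =
    ℕP.m≤m*n N (N ℕ.^ s) {{ℕP.m^n≢0 N s {{ℕ.>-nonZero 1≤N}}}}

-- Induction on s: the
-- last index contributes N^{s_1}·1 ≥ N, and every outer index s_i keeps its
-- largest term n_i = m-1, whose factor (N/(m-1))^{s_i} is ≥ 1.
nestedSum-lowerBound : ∀ s ss → All (1 ℕ.≤_) (s ∷ ss) → ∀ m N → length (s ∷ ss) ℕ.< m → m ℕ.≤ N →
                       ι N ≤ ι (N ℕ.^ weight (s ∷ ss)) * nestedSum m (s ∷ ss)
nestedSum-lowerBound s [] _ (suc zero) N (ℕ.s≤s ()) _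
nestedSum-lowerBound s [] (1≤s ∷ []) (suc (suc j)) N _ m≤N = begin
  ι N                                        ≤⟨ power-≥-base N (s ℕ.+ 0) 1≤N (ℕP.≤-trans 1≤s (ℕP.m≤m+n s 0)) ⟩
  ι (N ℕ.^ (s ℕ.+ 0)) * inversePower 0 (s ℕ.+ 0) ≡⟨ cong (λ t → ι (N ℕ.^ (s ℕ.+ 0)) * inversePower 0 t) (ℕP.+-identityʳ s) ⟩
  ι (N ℕ.^ (s ℕ.+ 0)) * inversePower 0 s     ≤⟨ *-monoˡ-≤ _ (0≤-ι (N ℕ.^ (s ℕ.+ 0))) (nestedSum-firstTerm j s) ⟩
  ι (N ℕ.^ (s ℕ.+ 0)) * nestedSum (suc (suc j)) (s ∷ []) ∎
  where
  open ℚP.≤-Reasoning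
  1≤N : 1 ℕ.≤ N
  1≤N = ℕP.≤-trans (ℕ.s≤s ℕ.z≤n) m≤N
nestedSum-lowerBound s (t ∷ ts) (1≤s ∷ all≥1) (suc (suc j)) N (ℕ.s≤s d<m) m≤N = begin
  ι N                                   ≡⟨ sym (ℚP.*-identityˡ (ι N)) ⟩
  1ℚ * ι N                              ≤⟨ *-monoʳ-≤ (ι N) (0≤-ι N) (powerRatio-≥1 j N s k≤N) ⟩
  (a * u) * ι N                         ≤⟨ *-monoˡ-≤ (a * u) (0≤-* (0≤-ι (N ℕ.^ s)) (0≤-inversePower j s))
                                             (nestedSum-lowerBound t ts all≥1 (suc j) N d<m k≤N) ⟩
  (a * u) * (b * S)                     ≡⟨ solve 4 (λ a b u S → (a :* u) :* (b :* S) := (a :* b) :* (u :* S)) refl a b u S ⟩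
  (a * b) * (u * S)                     ≡⟨ cong (_* (u * S)) (sym (ι-* (N ℕ.^ s) (N ℕ.^ w))) ⟩
  ι (N ℕ.^ s ℕ.* N ℕ.^ w) * (u * S)     ≡⟨ cong (λ e → ι e * (u * S)) (sym (ℕP.^-distribˡ-+-* N s w)) ⟩
  ι (N ℕ.^ (s ℕ.+ w)) * (u * S)         ≤⟨ *-monoˡ-≤ _ (0≤-ι (N ℕ.^ (s ℕ.+ w))) (nestedSum-lastTerm j s (t ∷ ts)) ⟩
  ι (N ℕ.^ (s ℕ.+ w)) * nestedSum (suc (suc j)) (s ∷ t ∷ ts) ∎
  where
  open ℚP.≤-Reasoning
  w = weight (t ∷ ts)
  a = ι (N ℕ.^ s)
  b = ι (N ℕ.^ w)
  u = inversePower j s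
  S = nestedSum (suc j) (t ∷ ts)
  k≤N : suc j ℕ.≤ N
  k≤N = ℕP.≤-trans (ℕP.n≤1+n (suc j)) m≤N

har-lowerBound : ∀ s → 1 ℕ.≤ length s → All (1 ℕ.≤_) s → ∀ n → length s ℕ.< n → ι n ≤ har n s
har-lowerBound (s ∷ ss) _ all≥1 n d<n = nestedSum-lowerBound s ss all≥1 n n d<n ℕP.≤-refl

-- Polynomials at infinity

BoundedAwayFromZero : Poly → Set
BoundedAwayFromZero P = Σ ℚ λ B → Σ ℚ λ δ → 0ℚ < δ × (∀ x → B ≤ x → δ ≤ ∣ eval P x ∣)

eval-zeroPoly : ∀ cs → ¬ NonZeroPoly cs → ∀ x → eval cs x ≡ 0ℚ
eval-zeroPoly [] _ x = refl
eval-zeroPoly (c ∷ cs) allZero x = begin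
  c + x * eval cs x  ≡⟨ cong₂ (λ a e → a + x * e) c≡0 (eval-zeroPoly cs (λ nz → allZero (there nz)) x) ⟩
  0ℚ + x * 0ℚ        ≡⟨ cong (λ y → 0ℚ + y) (ℚP.*-zeroʳ x) ⟩
  0ℚ                 ∎
  where
  open ≡-Reasoning
  c≡0 : c ≡ 0ℚ
  c≡0 = decidable-stable (c ℚ.≟ 0ℚ) (λ c≢0 → allZero (here c≢0))

0<∣c∣ : ∀ c → ¬ c ≡ 0ℚ → 0ℚ < ∣ c ∣
0<∣c∣ c c≢0 with ℚP.<-cmp 0ℚ ∣ c ∣
... | tri< 0<∣c∣ _ _ = 0<∣c∣
... | tri≈ _ 0≡∣c∣ _ = ⊥-elim (c≢0 (ℚP.∣p∣≡0⇒p≡0 c (sym 0≡∣c∣)))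
... | tri> _ _ ∣c∣<0 = ⊥-elim (ℚP.<-irrefl refl (ℚP.≤-<-trans (ℚP.0≤∣p∣ c) ∣c∣<0))

-- Horner step: if |Q(x)| ≥ δ for x ≥ B, then |c + x·Q(x)| ≥ δ for
-- x ≥ max(B, (|c| + δ)/δ), since there  |x·Q(x)| ≥ |c| + δ.
horner-boundedAway : ∀ c cs → BoundedAwayFromZero cs → BoundedAwayFromZero (c ∷ cs)
horner-boundedAway c cs (B , δ , 0<δ , bound) =
  B ⊔ E , δ , 0<δ , λ x B⊔E≤x → away x (ℚP.≤-trans (ℚP.p≤p⊔q B E) B⊔E≤x) (ℚP.≤-trans (ℚP.p≤q⊔p B E) B⊔E≤x)
  where
  instance
    δ≢0 : ℚ.NonZero δ
    δ≢0 = ℚP.pos⇒nonZero δ {{ℚ.positive 0<δ}}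

  0≤δ : 0ℚ ≤ δ
  0≤δ = ℚP.<⇒≤ 0<δ

  E : ℚ
  E = (∣ c ∣ + δ) * 1/ δ

  0≤E : 0ℚ ≤ E
  0≤E = 0≤-* (ℚP.+-mono-≤ (ℚP.0≤∣p∣ c) 0≤δ) (ℚP.<⇒≤ (ℚP.positive⁻¹ (1/ δ) {{ℚP.1/pos⇒pos δ {{ℚ.positive 0<δ}}}}))

  E*δ≡∣c∣+δ : E * δ ≡ ∣ c ∣ + δ
  E*δ≡∣c∣+δ = trans (ℚP.*-assoc (∣ c ∣ + δ) (1/ δ) δ)
                (trans (cong ((∣ c ∣ + δ) *_) (ℚP.*-inverseˡ δ)) (ℚP.*-identityʳ _))

  away : ∀ x → B ≤ x → E ≤ x → δ ≤ ∣ c + x * eval cs x ∣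
  away x B≤x E≤x = +-cancelʳ-≤ δ ∣ c + x * e ∣ ∣ c ∣ (begin
    δ + ∣ c ∣                ≡⟨ trans (ℚP.+-comm δ ∣ c ∣) (sym E*δ≡∣c∣+δ) ⟩
    E * δ                    ≤⟨ *-monoʳ-≤ δ 0≤δ E≤x ⟩
    x * δ                    ≤⟨ *-monoˡ-≤ x 0≤x (bound x B≤x) ⟩
    x * ∣ e ∣                ≡⟨ cong (_* ∣ e ∣) (sym (ℚP.0≤p⇒∣p∣≡p 0≤x)) ⟩
    ∣ x ∣ * ∣ e ∣            ≡⟨ sym (ℚP.∣p*q∣≡∣p∣*∣q∣ x e) ⟩
    ∣ x * e ∣                ≡⟨ cong ∣_∣ (solve 3 (λ c x e → x :* e := (c :+ x :* e) :+ (:- c)) refl c x e) ⟩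
    ∣ (c + x * e) + - c ∣    ≤⟨ ℚP.∣p+q∣≤∣p∣+∣q∣ (c + x * e) (- c) ⟩
    ∣ c + x * e ∣ + ∣ - c ∣  ≡⟨ cong (λ y → ∣ c + x * e ∣ + y) (ℚP.∣-p∣≡∣p∣ c) ⟩
    ∣ c + x * e ∣ + ∣ c ∣    ∎)
    where
    open ℚP.≤-Reasoning
    e = eval cs x
    0≤x : 0ℚ ≤ x
    0≤x = ℚP.≤-trans 0≤E E≤x

nonZero⇒boundedAwayFromZero : ∀ P → NonZeroPoly P → BoundedAwayFromZero P
nonZero⇒boundedAwayFromZero (c ∷ cs) nz with Any.any? (λ d → ¬? (d ℚ.≟ 0ℚ)) cs
... | yes cs≢0 = horner-boundedAway c cs (nonZero⇒boundedAwayFromZero cs cs≢0)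
... | no cs≡0 = 0ℚ , ∣ c ∣ , 0<∣c∣ c c≢0 , λ x _ → ℚP.≤-reflexive (cong ∣_∣ (sym (constant x)))
  where
  head≢0 : NonZeroPoly (c ∷ cs) → ¬ c ≡ 0ℚ
  head≢0 (here c≢0) = c≢0
  head≢0 (there cs≢0) = ⊥-elim (cs≡0 cs≢0)

  c≢0 : ¬ c ≡ 0ℚ
  c≢0 = head≢0 nz

  constant : ∀ x → c + x * eval cs x ≡ c
  constant x = trans (cong (λ e → c + x * e) (eval-zeroPoly cs cs≡0 x))
                 (trans (cong (λ y → c + y) (ℚP.*-zeroʳ x)) (ℚP.+-identityʳ c))

-- Transcendence criterion

Unbounded : (ℕ → Set) → (ℕ → ℚ) → Set
Unbounded I a = ∀ B → ∃ λ n → I n × B ≤ a n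

-- An unbounded family is not algebraic: a non-zero polynomial killing it
-- would vanish at points arbitrarily far out, where it is ≥ δ > 0 in size.
unbounded⇒¬algebraic : ∀ I a → Unbounded I a → ¬ AlgebraicFamily I (λ n _ → a n)
unbounded⇒¬algebraic I a unbounded (P , P≢0 , P[a]≡0) with nonZero⇒boundedAwayFromZero P P≢0
... | B , δ , 0<δ , bound with unbounded B
... | n , n∈I , B≤aₙ = ℚP.<-irrefl refl (ℚP.<-≤-trans 0<δ δ≤0)
  where
  δ≤0 : δ ≤ 0ℚ
  δ≤0 = subst (λ y → δ ≤ ∣ y ∣) (P[a]≡0 n n∈I) (bound (a n) B≤aₙ)

mainTheorem2 : (s : List ℕ) → 1 ℕ.≤ length s → All (λ sᵢ → 1 ℕ.≤ sᵢ) s →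
    (I : ℕ → Set) → (∀ n → I n → IsPrimePower n) → Infinite I →
    ¬ AlgebraicFamily I (λ n _ → har n s)
mainTheorem2 s 1≤d all≥1 I _ infinite = unbounded⇒¬algebraic I (λ n → har n s) unbounded
  where
  unbounded : Unbounded I (λ n → har n s)
  unbounded B with archimedean B
  ... | m , B≤m with infinite (m ℕ.⊔ length s)
  ... | n , m⊔d<n , n∈I = n , n∈I , ℚP.≤-trans B≤m (ℚP.≤-trans (ι-mono-≤ m≤n) (har-lowerBound s 1≤d all≥1 n d<n))
    where
    m≤n : m ℕ.≤ n
    m≤n = ℕP.<⇒≤ (ℕP.≤-<-trans (ℕP.m≤m⊔n m (length s)) m⊔d<n)
    d<n : length s ℕ.< n
    d<n = ℕP.≤-<-trans (ℕP.m≤n⊔m m (length s)) m⊔d<n
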